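{- Let $\Gamma$ be an instance of Satisfiability (a Boolean formula in conjunctive normal form) with variables $x_1,\ldots,x_n$ and clauses $c_1,\ldots,c_m$ such that every clause contains two or three literals, every positive literal appears in at most two different clauses, every negative literal appears in at most one clause, and no clause contains a literal and its negation. For $j\in[m]$ let $|c_j|$ be the number of literals in $c_j$. Let $G$ be the graph obtained as follows: take $n$ disjoint triangles with vertex sets $X_i=\{t_i,f_i,u_i\}$, $i\in[n]$, and $m$ disjoint cliques with vertex sets $C_1,\ldots,C_m$ (disjoint from the triangles), where $|C_j|=|c_j|+1$; in each $C_j$ identify $|c_j|$ of its vertices with the literals of $c_j$ (one vertex per literal occurrence), and let $v_j$ be the remaining vertex of $C_j$. Then, for every $i\in[n]$, join $f_i$ by an edge to every vertex of $\bigcup_{j=1}^m C_j$ identified with the literal $x_i$, and join $t_i$ by an edge to every vertex of $\bigcup_{j=1}^m C_j$ identified with the literal $\bar{x}_i$. Then $\Gamma$ is satisfiable if and only if $\nu_{ac}(G)=\nu_s(G)$.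
   Context: For a graph $G$ and a matching $M$ in $G$, $G(M)$ is the subgraph of $G$ induced by the set of vertices covered by $M$. A matching $M$ is induced if $G(M)$ is $1$-regular and acyclic if $G(M)$ is a forest; $\nu_s(G)$ and $\nu_{ac}(G)$ denote the maximum cardinality of an induced, respectively acyclic, matching in $G$. $[k]=\{1,\ldots,k\}$. -}

module Defs where

open import Data.Nat using (ℕ; _≤_)
open import Data.Fin using (Fin)
open import Data.Bool using (Bool; true; false)
open import Data.List using (List; []; _∷_; length; lookup; concatMap; _++_)
open import Data.List.Membership.Propositional using (_∈_)
open import Data.List.Relation.Unary.All using (All)
open import Data.List.Relation.Unary.Any using (Any)
open import Data.List.Relation.Unary.Unique.Propositional using (Unique)
open import Data.List.Relation.Unary.Linked using (Linked)
open import Data.Product using (Σ; ∃; _×_; _,_)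
open import Data.Sum using (_⊎_)
open import Relation.Binary.PropositionalEquality using (_≡_; _≢_)
open import Relation.Nullary using (¬_)

-- Generic graph notions for a graph with vertex type V and adjacency E
-- (E is assumed symmetric and irreflexive; the graph G below is).

module GraphNotions {V : Set} (E : V → V → Set) where

  ends : List (V × V) → List V
  ends = concatMap (λ { (u , v) → u ∷ v ∷ [] })

  IsMatching : List (V × V) → Set
  IsMatching M = All (λ { (u , v) → E u v }) M × Unique (ends M)

  -- G(M) is 1-regular: the only edges of G(M) are those of M.
  IsInduced : List (V × V) → Set
  IsInduced M = ∀ u v → u ∈ ends M → v ∈ ends M → E u v →
                (u , v) ∈ M ⊎ (v , u) ∈ M

  CycleIn : List V → Set
  CycleIn S = Σ V λ v → Σ (List V) λ ws →
    (2 ≤ length ws) × Unique (v ∷ ws) × All (_∈ S) (v ∷ ws) ×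
    Linked E (v ∷ ws ++ v ∷ [])

  IsAcyclic : List (V × V) → Set
  IsAcyclic M = ¬ CycleIn (ends M)

  IsNuS : ℕ → Set
  IsNuS k = (Σ (List (V × V)) λ M → IsMatching M × IsInduced M × length M ≡ k)
          × (∀ M → IsMatching M → IsInduced M → length M ≤ k)

  IsNuAc : ℕ → Set
  IsNuAc k = (Σ (List (V × V)) λ M → IsMatching M × IsAcyclic M × length M ≡ k)
           × (∀ M → IsMatching M → IsAcyclic M → length M ≤ k)

  NuAcEqNuS : Set
  NuAcEqNuS = ∃ λ k → IsNuAc k × IsNuS k

data Lit (n : ℕ) : Set where
  pos : Fin n → Lit n
  neg : Fin n → Lit n

-- a formula with variables Fin n and clauses c : Fin m → List (Lit n)
-- (a clause is a list of distinct literals, i.e. a set of literals)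

evalLit : ∀ {n} → (Fin n → Bool) → Lit n → Set
evalLit a (pos i) = a i ≡ true
evalLit a (neg i) = a i ≡ false

Satisfiable : ∀ {n m} → (Fin m → List (Lit n)) → Set
Satisfiable {n} c = Σ (Fin n → Bool) λ a → ∀ j → Any (evalLit a) (c j)

record Restricted {n m : ℕ} (c : Fin m → List (Lit n)) : Set where
  field
    distinctLits : ∀ j → Unique (c j)
    size23       : ∀ j → length (c j) ≡ 2 ⊎ length (c j) ≡ 3
    posAtMost2   : ∀ i j₁ j₂ j₃ → pos i ∈ c j₁ → pos i ∈ c j₂ → pos i ∈ c j₃ →
                   j₁ ≡ j₂ ⊎ j₁ ≡ j₃ ⊎ j₂ ≡ j₃
    negAtMost1   : ∀ i j₁ j₂ → neg i ∈ c j₁ → neg i ∈ c j₂ → j₁ ≡ j₂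
    noComplement : ∀ i j → ¬ (pos i ∈ c j × neg i ∈ c j)

data TFU : Set where
  T F U : TFU

module Construction {n m : ℕ} (c : Fin m → List (Lit n)) where

  data V : Set where
    tri : Fin n → TFU → V
    lit : (j : Fin m) → Fin (length (c j)) → V
    cv  : Fin m → V

  data Adj : V → V → Set where
    triangle : ∀ {i k k'} → k ≢ k' → Adj (tri i k) (tri i k')
    litlit   : ∀ {j p q} → p ≢ q → Adj (lit j p) (lit j q)
    litv     : ∀ {j p} → Adj (lit j p) (cv j)
    vlit     : ∀ {j p} → Adj (cv j) (lit j p)
    fpos     : ∀ {i j p} → lookup (c j) p ≡ pos i → Adj (tri i F) (lit j p)
    posf     : ∀ {i j p} → lookup (c j) p ≡ pos i → Adj (lit j p) (tri i F)
    tneg     : ∀ {i j p} → lookup (c j) p ≡ neg i → Adj (tri i T) (lit j p)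
    negt     : ∀ {i j p} → lookup (c j) p ≡ neg i → Adj (lit j p) (tri i T)

-- The cliques X_i and C_j partition G. An acyclic matching covers at most two vertices of each
-- clique (three would span a triangle), so ν_ac(G) ≤ n + m. The matching {t_i u_i} ∪ {ℓ_j v_j},
-- with ℓ_j some literal vertex of C_j, attains this bound: its vertices can be layered
-- u_i < t_i < ℓ_j < v_j so that each one has at most one neighbour below and one above (x̄_i lies
-- in at most one clause), and a graph so layered has no cycle. Hence ν_ac(G) = ν_s(G) iff G has an
-- induced matching of size n + m. Such a matching uses one edge inside every clique, and the only
-- edges of G(M) it must exclude join a covered f_i (resp. t_i) to a covered vertex labelled x_i
-- (resp. x̄_i). So a satisfying assignment, read as t_i u_i or f_i u_i plus a true literal per
-- clause, gives one; conversely, setting x_i true iff f_i is uncovered satisfies every clause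
-- through the literal vertex matched in its clique.
module Submission where

open import Data.Bool using (Bool; true; false; not)
open import Data.Empty using (⊥; ⊥-elim)
open import Data.Fin as Fin using (Fin; splitAt; join)
open import Data.Fin.Properties using (splitAt-join; join-splitAt)
open import Data.List using (List; []; _∷_; [_]; _++_; length; map; filter; allFin; lookup)
open import Data.List.Properties using (length-map; filter-accept)
open import Data.List.Membership.Propositional using (_∈_; _∉_)
open import Data.List.Membership.Propositional.Properties
  using (∈-map⁺; ∈-map⁻; ∈-allFin; ∈-lookup; ∈-filter⁻)
open import Data.List.Relation.Unary.All as All using (All; []; _∷_)
open import Data.List.Relation.Unary.Any as Any using (Any; here; there; any?)
open import Data.List.Relation.Unary.Any.Properties using (lookup-index)
open import Data.List.Relation.Unary.AllPairs using ([]; _∷_)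
open import Data.List.Relation.Unary.Linked using (Linked; [-]; _∷_)
open import Data.List.Relation.Unary.Linked.Properties using (Linked⇒AllPairs)
open import Data.List.Relation.Unary.Unique.Propositional using (Unique)
open import Data.List.Relation.Unary.Unique.Propositional.Properties using (map⁺; allFin⁺; filter⁺)
open import Data.Nat using (ℕ; _+_; _*_; _≤_; _<_; z≤n; s≤s; _≤?_)
open import Data.Nat.ListAction using (sum)
open import Data.Nat.Properties
open import Data.Product using (∃; _×_; _,_; proj₁; proj₂)
open import Data.Sum using (_⊎_; inj₁; inj₂; swap)
open import Data.Sum.Properties using (≡-dec)
open import Function using (_∘_)
open import Function.Bundles using (_⇔_; mk⇔)
open import Relation.Binary.Definitions using (DecidableEquality; Transitive)
open import Relation.Binary.PropositionalEquality using (_≡_; _≢_; refl; sym; trans; cong; subst)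
open import Relation.Nullary using (¬_; Dec; yes; no; does)
open import Relation.Nullary.Decidable using (map′)

open import Defs

sum-map-mono-≤ : ∀ {A : Set} {f g : A → ℕ} → (∀ a → f a ≤ g a) →
                 ∀ xs → sum (map f xs) ≤ sum (map g xs)
sum-map-mono-≤ f≤g []       = z≤n
sum-map-mono-≤ f≤g (x ∷ xs) = +-mono-≤ (f≤g x) (sum-map-mono-≤ f≤g xs)

sum-map-mono-< : ∀ {A : Set} {f g : A → ℕ} → (∀ a → f a ≤ g a) →
                 ∀ {x xs} → x ∈ xs → f x < g x → sum (map f xs) < sum (map g xs)
sum-map-mono-< f≤g {xs = _ ∷ xs} (here refl) fx<gx = +-mono-<-≤ fx<gx (sum-map-mono-≤ f≤g xs)
sum-map-mono-< f≤g {xs = y ∷ _}  (there x∈)  fx<gx = +-mono-≤-< (f≤g y) (sum-map-mono-< f≤g x∈ fx<gx)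

sum-map-const : ∀ {A : Set} k (xs : List A) → sum (map (λ _ → k) xs) ≡ k * length xs
sum-map-const k []       = sym (*-zeroʳ k)
sum-map-const k (_ ∷ xs) = trans (cong (k +_) (sum-map-const k xs)) (sym (*-suc k (length xs)))

linked-last : ∀ {A : Set} {R : A → A → Set} {y} x xs →
              Linked R (x ∷ xs ++ [ y ]) → ∃ λ z → z ∈ x ∷ xs × R z y
linked-last x []        (r ∷ _) = x , here refl , r
linked-last x (x′ ∷ xs) (_ ∷ l) with z , z∈ , r ← linked-last x′ xs l = z , there z∈ , r

module MatchingProperties {V : Set} (E : V → V → Set) where

  open GraphNotions E

  infix 4 _∈ₑ_

  _∈ₑ_ : V → V × V → Set
  x ∈ₑ A = x ≡ proj₁ A ⊎ x ≡ proj₂ A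

  ∈ₑ-pair : ∀ {x y A} → x ≢ y → x ∈ₑ A → y ∈ₑ A → A ≡ (x , y) ⊎ A ≡ (y , x)
  ∈ₑ-pair x≢y (inj₁ refl) (inj₁ refl) = ⊥-elim (x≢y refl)
  ∈ₑ-pair x≢y (inj₁ refl) (inj₂ refl) = inj₁ refl
  ∈ₑ-pair x≢y (inj₂ refl) (inj₁ refl) = inj₂ refl
  ∈ₑ-pair x≢y (inj₂ refl) (inj₂ refl) = ⊥-elim (x≢y refl)

  ∈ₑ⇒∈ends : ∀ {M A x} → A ∈ M → x ∈ₑ A → x ∈ ends M
  ∈ₑ⇒∈ends (here refl) (inj₁ refl) = here refl
  ∈ₑ⇒∈ends (here refl) (inj₂ refl) = there (here refl)
  ∈ₑ⇒∈ends (there A∈)  xA          = there (there (∈ₑ⇒∈ends A∈ xA))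

  ∈ends⇒∈ₑ : ∀ {M x} → x ∈ ends M → ∃ λ A → A ∈ M × x ∈ₑ A
  ∈ends⇒∈ₑ {_ ∷ _} (here refl)         = _ , here refl , inj₁ refl
  ∈ends⇒∈ₑ {_ ∷ _} (there (here refl)) = _ , here refl , inj₂ refl
  ∈ends⇒∈ₑ {_ ∷ _} (there (there x∈)) with A , A∈ , xA ← ∈ends⇒∈ₑ x∈ = A , there A∈ , xA

  ∈ends-map⁻ : ∀ {I : Set} {g : I → V × V} {is x} → x ∈ ends (map g is) → ∃ λ i → i ∈ is × x ∈ₑ g i
  ∈ends-map⁻ {g = g} x∈ with A , A∈ , xA ← ∈ends⇒∈ₑ x∈ with i , i∈ , refl ← ∈-map⁻ g A∈ = i , i∈ , xA

  length-ends : ∀ M → length (ends M) ≡ 2 * length M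
  length-ends []      = refl
  length-ends (_ ∷ M) = trans (cong (2 +_) (length-ends M)) (sym (*-suc 2 (length M)))

  private
    unmatched-below : ∀ {A M x} → Unique (ends (A ∷ M)) → x ∈ₑ A → x ∉ ends M
    unmatched-below ((_ ∷ a∉) ∷ _) (inj₁ refl) x∈ = All.lookup a∉ x∈ refl
    unmatched-below (_ ∷ b∉ ∷ _)   (inj₂ refl) x∈ = All.lookup b∉ x∈ refl

  matched-pair-unique : ∀ {M A B x} → Unique (ends M) → A ∈ M → B ∈ M → x ∈ₑ A → x ∈ₑ B → A ≡ B
  matched-pair-unique _           (here refl) (here refl) _  _  = refl
  matched-pair-unique {_ ∷ M} u   (here refl) (there B∈)  xA xB = ⊥-elim (unmatched-below {M = M} u xA (∈ₑ⇒∈ends B∈ xB))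
  matched-pair-unique {_ ∷ M} u   (there A∈)  (here refl) xA xB = ⊥-elim (unmatched-below {M = M} u xB (∈ₑ⇒∈ends A∈ xA))
  matched-pair-unique (_ ∷ _ ∷ u) (there A∈)  (there B∈)  xA xB = matched-pair-unique u A∈ B∈ xA xB

  induced-covered-neighbour : ∀ {M A x w} → IsMatching M → IsInduced M →
                      A ∈ M → x ∈ₑ A → w ∈ ends M → E x w → w ∈ₑ A
  induced-covered-neighbour (_ , u) ind A∈ xA w∈ e with ind _ _ (∈ₑ⇒∈ends A∈ xA) w∈ e
  ... | inj₁ xw∈ with refl ← matched-pair-unique u A∈ xw∈ xA (inj₁ refl) = inj₂ refl
  ... | inj₂ wx∈ with refl ← matched-pair-unique u A∈ wx∈ xA (inj₂ refl) = inj₁ refl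

  induced⇒acyclic : ∀ {M} → IsMatching M → IsInduced M → IsAcyclic M
  induced⇒acyclic _ _ (_ , [] , () , _)
  induced⇒acyclic _ _ (_ , _ ∷ [] , s≤s () , _)
  induced⇒acyclic mt ind (v , w₁ ∷ w₂ ∷ _ , _ , ((v≢w₁ ∷ v≢w₂ ∷ _) ∷ (w₁≢w₂ ∷ _) ∷ _) ,
                          (v∈ ∷ w₁∈ ∷ w₂∈ ∷ _) , (e₁ ∷ e₂ ∷ _))
    with A , A∈ , vA ← ∈ends⇒∈ₑ v∈
    with w₁A ← induced-covered-neighbour mt ind A∈ vA w₁∈ e₁
    with ∈ₑ-pair v≢w₁ vA w₁A | induced-covered-neighbour mt ind A∈ w₁A w₂∈ e₂
  ... | inj₁ refl | inj₁ w₂≡v  = v≢w₂ (sym w₂≡v)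
  ... | inj₁ refl | inj₂ w₂≡w₁ = w₁≢w₂ (sym w₂≡w₁)
  ... | inj₂ refl | inj₁ w₂≡w₁ = w₁≢w₂ (sym w₂≡w₁)
  ... | inj₂ refl | inj₂ w₂≡v  = v≢w₂ (sym w₂≡v)

  triangle-cycle : ∀ {S x y z} → x ≢ y → x ≢ z → y ≢ z → x ∈ S → y ∈ S → z ∈ S →
                   E x y → E y z → E z x → CycleIn S
  triangle-cycle x≢y x≢z y≢z x∈ y∈ z∈ exy eyz ezx =
    _ , _ ∷ _ ∷ [] , s≤s (s≤s z≤n) , ((x≢y ∷ x≢z ∷ []) ∷ (y≢z ∷ []) ∷ [] ∷ []) ,
    (x∈ ∷ y∈ ∷ z∈ ∷ []) , (exy ∷ eyz ∷ ezx ∷ [-])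

module Layering {V : Set} (E : V → V → Set) (S : List V) (E-sym : ∀ {x y} → E x y → E y x) where

  open GraphNotions E

  private
    module Ascending
      (_≺_ : V → V → Set) (≺-trans : Transitive _≺_)
      (comparable : ∀ {x y} → x ∈ S → y ∈ S → E x y → x ≺ y ⊎ y ≺ x)
      (one-lower : ∀ {x y z} → x ∈ S → y ∈ S → z ∈ S → E y x → E y z → x ≺ y → z ≺ y → x ≡ z)
      (one-upper : ∀ {x y z} → x ∈ S → y ∈ S → z ∈ S → E y x → E y z → y ≺ x → y ≺ z → x ≡ z)
      where

      climb : ∀ {x y z} → x ∈ S → y ∈ S → z ∈ S → E x y → E y z → x ≢ z → x ≺ y → y ≺ z
      climb x∈ y∈ z∈ exy eyz x≢z x≺y with comparable y∈ z∈ eyz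
      ... | inj₁ y≺z = y≺z
      ... | inj₂ z≺y = ⊥-elim (x≢z (one-lower x∈ y∈ z∈ (E-sym exy) eyz x≺y z≺y))

      ascending : ∀ {x y} ys zs → Unique (x ∷ y ∷ ys) → All (_∈ S) (x ∷ y ∷ ys) →
                  Linked E (x ∷ y ∷ ys ++ zs) → x ≺ y → Linked _≺_ (x ∷ y ∷ ys)
      ascending []       _  _                   _                          _            x≺y = x≺y ∷ [-]
      ascending (_ ∷ ys) zs ((_ ∷ x≢z ∷ _) ∷ u) (x∈ ∷ s@(y∈ ∷ z∈ ∷ _)) (exy ∷ l@(eyz ∷ _)) x≺y =
        x≺y ∷ ascending ys zs u s l (climb x∈ y∈ z∈ exy eyz x≢z x≺y)

      -- The path v, w₁, …, w_k climbs all the way, so both neighbours w₁ and w_k of v lie above v.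
      no-ascending-cycle : ∀ {v w₁ w₂} ws → Unique (v ∷ w₁ ∷ w₂ ∷ ws) → All (_∈ S) (v ∷ w₁ ∷ w₂ ∷ ws) →
                           Linked E (v ∷ w₁ ∷ w₂ ∷ ws ++ [ v ]) → v ≺ w₁ → ⊥
      no-ascending-cycle ws u@(_ ∷ w₁∉ ∷ _) s@(v∈ ∷ w₁∈ ∷ ws∈) l@(evw₁ ∷ _ ∷ l′) v≺w₁
        with w , w∈ , ewv ← linked-last _ ws l′
        with v≺ws ∷ _ ← Linked⇒AllPairs ≺-trans (ascending (_ ∷ ws) [ _ ] u s l v≺w₁) =
        All.lookup w₁∉ w∈ (sym (one-upper (All.lookup ws∈ w∈) v∈ w₁∈ (E-sym ewv) evw₁
                                          (All.lookup v≺ws (there w∈)) v≺w₁))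

  layered⇒¬CycleIn :
    (_≺_ : V → V → Set) → Transitive _≺_ →
    (∀ {x y} → x ∈ S → y ∈ S → E x y → x ≺ y ⊎ y ≺ x) →
    (∀ {x y z} → x ∈ S → y ∈ S → z ∈ S → E y x → E y z → x ≺ y → z ≺ y → x ≡ z) →
    (∀ {x y z} → x ∈ S → y ∈ S → z ∈ S → E y x → E y z → y ≺ x → y ≺ z → x ≡ z) →
    ¬ CycleIn S
  layered⇒¬CycleIn _ _ _ _ _ (_ , [] , () , _)
  layered⇒¬CycleIn _ _ _ _ _ (_ , _ ∷ [] , s≤s () , _)
  layered⇒¬CycleIn _≺_ ≺-trans comparable one-lower one-upper
                   (v , _ ∷ _ ∷ ws , _ , u , s@(v∈ ∷ w₁∈ ∷ _) , l@(e ∷ _))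
    with comparable v∈ w₁∈ e
  ... | inj₁ v≺w₁ = Ascending.no-ascending-cycle _≺_ ≺-trans comparable one-lower one-upper ws u s l v≺w₁
  ... | inj₂ w₁≺v = Ascending.no-ascending-cycle (λ x y → y ≺ x) (λ p q → ≺-trans q p)
                      (λ x∈ y∈ e → swap (comparable x∈ y∈ e)) one-upper one-lower ws u s l w₁≺v

module CliquePartition
  {V P : Set} (E : V → V → Set) (part : V → P) (_≟_ : DecidableEquality P)
  (parts : List P) (∈-parts : ∀ p → p ∈ parts)
  (clique : ∀ {x y} → part x ≡ part y → x ≢ y → E x y)
  where

  open GraphNotions E
  open MatchingProperties E

  inPart : P → List V → List V
  inPart p = filter (λ x → part x ≟ p)

  private
    inPart-∷ : ∀ p x xs → length (inPart p xs) ≤ length (inPart p (x ∷ xs))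
    inPart-∷ p x xs with does (part x ≟ p)
    ... | true  = n≤1+n _
    ... | false = ≤-refl

    inPart-own : ∀ x xs → length (inPart (part x) xs) < length (inPart (part x) (x ∷ xs))
    inPart-own x xs = ≤-reflexive (sym (cong length (filter-accept (λ y → part y ≟ part x) refl)))

  length≤Σ-inPart : ∀ xs → length xs ≤ sum (map (λ p → length (inPart p xs)) parts)
  length≤Σ-inPart []       = z≤n
  length≤Σ-inPart (x ∷ xs) = ≤-trans (s≤s (length≤Σ-inPart xs))
                                     (sum-map-mono-< (λ p → inPart-∷ p x xs) (∈-parts (part x)) (inPart-own x xs))

  acyclic⇒inPart≤2 : ∀ {M} → IsMatching M → IsAcyclic M → ∀ p → length (inPart p (ends M)) ≤ 2
  acyclic⇒inPart≤2 {M} (_ , u) acyclic p = bound (inPart p (ends M)) (filter⁺ _ u) (∈-filter⁻ _)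
    where
    bound : ∀ ys → Unique ys → (∀ {x} → x ∈ ys → x ∈ ends M × part x ≡ p) → length ys ≤ 2
    bound []               _ _ = z≤n
    bound (_ ∷ [])         _ _ = s≤s z≤n
    bound (_ ∷ _ ∷ [])     _ _ = s≤s (s≤s z≤n)
    bound (x ∷ y ∷ z ∷ _) ((x≢y ∷ x≢z ∷ _) ∷ (y≢z ∷ _) ∷ _) mem
      with x∈ , px ← mem (here refl)
      with y∈ , py ← mem (there (here refl))
      with z∈ , pz ← mem (there (there (here refl))) =
      ⊥-elim (acyclic (triangle-cycle x≢y x≢z y≢z x∈ y∈ z∈
        (clique (trans px (sym py)) x≢y) (clique (trans py (sym pz)) y≢z) (clique (trans pz (sym px)) (x≢z ∘ sym))))

  private
    2*length≤Σ-inPart : ∀ M → 2 * length M ≤ sum (map (λ p → length (inPart p (ends M))) parts)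
    2*length≤Σ-inPart M = ≤-trans (≤-reflexive (sym (length-ends M))) (length≤Σ-inPart (ends M))

  acyclic-length≤ : ∀ {M} → IsMatching M → IsAcyclic M → length M ≤ length parts
  acyclic-length≤ {M} mt ac = *-cancelˡ-≤ 2 (begin
    2 * length M                                          ≤⟨ 2*length≤Σ-inPart M ⟩
    sum (map (λ p → length (inPart p (ends M))) parts)   ≤⟨ sum-map-mono-≤ (acyclic⇒inPart≤2 mt ac) parts ⟩
    sum (map (λ _ → 2) parts)                             ≡⟨ sum-map-const 2 parts ⟩
    2 * length parts                                      ∎)
    where open ≤-Reasoning

  -- Equality in the bound of acyclic-length≤ forces equality in every summand.
  large-acyclic⇒inPart≥2 : ∀ {M} → IsMatching M → IsAcyclic M → length parts ≤ length M →
                           ∀ p → 2 ≤ length (inPart p (ends M))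
  large-acyclic⇒inPart≥2 {M} mt ac big p with 2 ≤? length (inPart p (ends M))
  ... | yes two = two
  ... | no ¬two = ⊥-elim (<-irrefl refl (begin-strict
    2 * length parts                                      ≤⟨ *-monoʳ-≤ 2 big ⟩
    2 * length M                                          ≤⟨ 2*length≤Σ-inPart M ⟩
    sum (map (λ q → length (inPart q (ends M))) parts)   <⟨ sum-map-mono-< (acyclic⇒inPart≤2 mt ac) (∈-parts p) (≰⇒> ¬two) ⟩
    sum (map (λ _ → 2) parts)                             ≡⟨ sum-map-const 2 parts ⟩
    2 * length parts                                      ∎))
    where open ≤-Reasoning

  edge-in-each-part : ∀ {M} → IsMatching M → IsInduced M → length parts ≤ length M → ∀ p →
                      ∃ λ A → A ∈ M × proj₁ A ≢ proj₂ A × (∀ {z} → z ∈ₑ A → part z ≡ p)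
  edge-in-each-part {M} mt@(_ , u) ind big p =
    pick (inPart p (ends M)) (large-acyclic⇒inPart≥2 mt (induced⇒acyclic mt ind) big p) (filter⁺ _ u) (∈-filter⁻ _)
    where
    pick : ∀ ys → 2 ≤ length ys → Unique ys → (∀ {x} → x ∈ ys → x ∈ ends M × part x ≡ p) →
           ∃ λ A → A ∈ M × proj₁ A ≢ proj₂ A × (∀ {z} → z ∈ₑ A → part z ≡ p)
    pick (_ ∷ [])    (s≤s ()) _ _
    pick (x ∷ y ∷ _) _ ((x≢y ∷ _) ∷ _) mem
      with x∈ , px ← mem (here refl)
      with y∈ , py ← mem (there (here refl))
      with ind x y x∈ y∈ (clique (trans px (sym py)) x≢y)
    ... | inj₁ xy∈ = (x , y) , xy∈ , x≢y , λ { (inj₁ refl) → px ; (inj₂ refl) → py }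
    ... | inj₂ yx∈ = (y , x) , yx∈ , x≢y ∘ sym , λ { (inj₁ refl) → py ; (inj₂ refl) → px }

  module Choice
    (parts-unique : Unique parts) (E-irrefl : ∀ {x} → ¬ E x x) (g : P → V × V)
    (g-edge : ∀ p → E (proj₁ (g p)) (proj₂ (g p))) (g-part : ∀ p {x} → x ∈ₑ g p → part x ≡ p)
    where

    chosen : List (V × V)
    chosen = map g parts

    length-chosen : length chosen ≡ length parts
    length-chosen = length-map g parts

    covered⇒chosen : ∀ {x} → x ∈ ends chosen → x ∈ₑ g (part x)
    covered⇒chosen x∈ with p , _ , xp ← ∈ends-map⁻ {is = parts} x∈ = subst (λ q → _ ∈ₑ g q) (sym (g-part p xp)) xp

    private
      ends-unique : ∀ {ps} → Unique ps → Unique (ends (map g ps))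
      ends-unique []                 = []
      ends-unique {p ∷ ps} (p∉ ∷ u) =
        (ends≢ ∷ All.tabulate (fresh (inj₁ refl))) ∷ All.tabulate (fresh (inj₂ refl)) ∷ ends-unique u
        where
        ends≢ : proj₁ (g p) ≢ proj₂ (g p)
        ends≢ eq = E-irrefl (subst (λ y → E y (proj₂ (g p))) eq (g-edge p))
        fresh : ∀ {x y} → x ∈ₑ g p → y ∈ ends (map g ps) → x ≢ y
        fresh xp y∈ refl with q , q∈ , yq ← ∈ends-map⁻ {is = ps} y∈ =
          All.lookup p∉ q∈ (trans (sym (g-part p xp)) (g-part q yq))

    chosen-matching : IsMatching chosen
    chosen-matching = All.tabulate edge , ends-unique parts-unique
      where
      edge : ∀ {A} → A ∈ chosen → E (proj₁ A) (proj₂ A)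
      edge A∈ with p , _ , refl ← ∈-map⁻ g A∈ = g-edge p

    private
      adjacent-distinct : ∀ {x y} → E x y → x ≢ y
      adjacent-distinct e refl = E-irrefl e

    chosen-induced : (∀ {x y} → x ∈ ends chosen → y ∈ ends chosen → E x y → part x ≡ part y) →
                     IsInduced chosen
    chosen-induced same-part x y x∈ y∈ e
      with ∈ₑ-pair (adjacent-distinct e) (covered⇒chosen x∈)
                   (subst (λ q → y ∈ₑ g q) (sym (same-part x∈ y∈ e)) (covered⇒chosen y∈))
    ... | inj₁ gp≡xy = inj₁ (subst (_∈ chosen) gp≡xy (∈-map⁺ g (∈-parts (part x))))
    ... | inj₂ gp≡yx = inj₂ (subst (_∈ chosen) gp≡yx (∈-map⁺ g (∈-parts (part x))))

module Reduction {n m : ℕ} (c : Fin m → List (Lit n)) (R : Restricted c) where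

  open Construction c
  open Restricted R
  open GraphNotions Adj public
  open MatchingProperties Adj public

  Part : Set
  Part = Fin n ⊎ Fin m

  part : V → Part
  part (tri i _) = inj₁ i
  part (lit j _) = inj₂ j
  part (cv j)    = inj₂ j

  parts : List Part
  parts = map (splitAt n) (allFin (n + m))

  ∈-parts : ∀ p → p ∈ parts
  ∈-parts p = subst (_∈ parts) (splitAt-join n m p) (∈-map⁺ (splitAt n) (∈-allFin (join n m p)))

  parts-unique : Unique parts
  parts-unique = map⁺ splitAt-injective (allFin⁺ (n + m))
    where
    splitAt-injective : ∀ {i j} → splitAt n i ≡ splitAt n j → i ≡ j
    splitAt-injective {i} {j} eq =
      trans (sym (join-splitAt n m i)) (trans (cong (join n m) eq) (join-splitAt n m j))

  Adj-sym : ∀ {x y} → Adj x y → Adj y x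
  Adj-sym (triangle k≢k′) = triangle (k≢k′ ∘ sym)
  Adj-sym (litlit p≢q)    = litlit (p≢q ∘ sym)
  Adj-sym litv            = vlit
  Adj-sym vlit            = litv
  Adj-sym (fpos eq)       = posf eq
  Adj-sym (posf eq)       = fpos eq
  Adj-sym (tneg eq)       = negt eq
  Adj-sym (negt eq)       = tneg eq

  Adj-irrefl : ∀ {x} → ¬ Adj x x
  Adj-irrefl (triangle k≢k) = k≢k refl
  Adj-irrefl (litlit p≢p)   = p≢p refl

  Adj-clique : ∀ {x y} → part x ≡ part y → x ≢ y → Adj x y
  Adj-clique {tri _ _} {tri _ _} refl x≢y = triangle (x≢y ∘ cong (tri _))
  Adj-clique {lit _ _} {lit _ _} refl x≢y = litlit (x≢y ∘ cong (lit _))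
  Adj-clique {lit _ _} {cv _}    refl _   = litv
  Adj-clique {cv _}    {lit _ _} refl _   = vlit
  Adj-clique {cv _}    {cv _}    refl x≢y = ⊥-elim (x≢y refl)
  Adj-clique {tri _ _} {lit _ _} ()
  Adj-clique {tri _ _} {cv _}    ()
  Adj-clique {lit _ _} {tri _ _} ()
  Adj-clique {cv _}    {tri _ _} ()

  open CliquePartition Adj part (≡-dec Fin._≟_ Fin._≟_) parts ∈-parts Adj-clique public

  lookup∈ : ∀ {j p ℓ} → lookup (c j) p ≡ ℓ → ℓ ∈ c j
  lookup∈ {j} {p} eq = subst (_∈ c j) eq (∈-lookup p)

  value : Bool → TFU
  value true  = T
  value false = F

  choice : (Fin n → Bool) → (∀ j → Fin (length (c j))) → Part → V × V
  choice a w (inj₁ i) = tri i (value (a i)) , tri i U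
  choice a w (inj₂ j) = lit j (w j) , cv j

  choice-edge : ∀ a w p → Adj (proj₁ (choice a w p)) (proj₂ (choice a w p))
  choice-edge a w (inj₁ i) = triangle (value≢U (a i))
    where
    value≢U : ∀ b → value b ≢ U
    value≢U true  ()
    value≢U false ()
  choice-edge a w (inj₂ j) = litv

  choice-part : ∀ a w p {x} → x ∈ₑ choice a w p → part x ≡ p
  choice-part a w (inj₁ i) (inj₁ refl) = refl
  choice-part a w (inj₁ i) (inj₂ refl) = refl
  choice-part a w (inj₂ j) (inj₁ refl) = refl
  choice-part a w (inj₂ j) (inj₂ refl) = refl

  InChoice : (Fin n → Bool) → (∀ j → Fin (length (c j))) → V → Set
  InChoice a w x = x ∈ₑ choice a w (part x)

  module Chosen (a : Fin n → Bool) (w : ∀ j → Fin (length (c j))) =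
    Choice parts-unique Adj-irrefl (choice a w) (choice-edge a w) (choice-part a w)

  first-literal : ∀ j → Fin (length (c j))
  first-literal j with c j | size23 j
  ... | _ ∷ _ | _      = Fin.zero
  ... | []    | inj₁ ()
  ... | []    | inj₂ ()

  module Baseline = Chosen (λ _ → true) first-literal

  OnBaseline : V → Set
  OnBaseline = InChoice (λ _ → true) first-literal

  rank : V → ℕ
  rank (tri _ U) = 0
  rank (tri _ T) = 1
  rank (tri _ F) = 1
  rank (lit _ _) = 2
  rank (cv _)    = 3

  _≺_ : V → V → Set
  x ≺ y = rank x < rank y

  literal-neighbour : Lit n → V
  literal-neighbour (pos i) = tri i F
  literal-neighbour (neg i) = tri i T

  -- The neighbour one layer down; junk at u_i, which has none.
  lower-neighbour : V → V
  lower-neighbour (tri i _) = tri i U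
  lower-neighbour (lit j p) = literal-neighbour (lookup (c j) p)
  lower-neighbour (cv j)    = lit j (first-literal j)

  ≺-comparable : ∀ {x y} → Adj x y → OnBaseline x → OnBaseline y → x ≺ y ⊎ y ≺ x
  ≺-comparable (triangle T≢T) (inj₁ refl) (inj₁ refl) = ⊥-elim (T≢T refl)
  ≺-comparable (triangle _)   (inj₁ refl) (inj₂ refl) = inj₂ ≤-refl
  ≺-comparable (triangle _)   (inj₂ refl) (inj₁ refl) = inj₁ ≤-refl
  ≺-comparable (triangle U≢U) (inj₂ refl) (inj₂ refl) = ⊥-elim (U≢U refl)
  ≺-comparable (litlit p≢p)   (inj₁ refl) (inj₁ refl) = ⊥-elim (p≢p refl)
  ≺-comparable (litlit _)     (inj₂ ())   _
  ≺-comparable (litlit _)     (inj₁ refl) (inj₂ ())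
  ≺-comparable litv           _           _           = inj₁ ≤-refl
  ≺-comparable vlit           _           _           = inj₂ ≤-refl
  ≺-comparable (fpos _)       (inj₁ ())   _
  ≺-comparable (fpos _)       (inj₂ ())   _
  ≺-comparable (posf _)       _           (inj₁ ())
  ≺-comparable (posf _)       _           (inj₂ ())
  ≺-comparable (tneg _)       _           _           = inj₁ ≤-refl
  ≺-comparable (negt _)       _           _           = inj₂ ≤-refl

  ≺-lower-neighbour : ∀ {x y} → Adj y x → OnBaseline y → OnBaseline x → x ≺ y → x ≡ lower-neighbour y
  ≺-lower-neighbour (triangle _)   (inj₁ refl) (inj₂ refl) _ = refl
  ≺-lower-neighbour (triangle T≢T) (inj₁ refl) (inj₁ refl) _ = ⊥-elim (T≢T refl)
  ≺-lower-neighbour (triangle _)   (inj₂ refl) _           ()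
  ≺-lower-neighbour (tneg _)       _           _           (s≤s ())
  ≺-lower-neighbour (fpos _)       (inj₁ ())   _           _
  ≺-lower-neighbour (fpos _)       (inj₂ ())   _           _
  ≺-lower-neighbour (litlit p≢p)   (inj₁ refl) (inj₁ refl) _ = ⊥-elim (p≢p refl)
  ≺-lower-neighbour (litlit _)     (inj₂ ())   _           _
  ≺-lower-neighbour (litlit _)     (inj₁ refl) (inj₂ ())   _
  ≺-lower-neighbour litv           _           _           (s≤s (s≤s ()))
  ≺-lower-neighbour (posf _)       _           (inj₁ ())   _
  ≺-lower-neighbour (posf _)       _           (inj₂ ())   _
  ≺-lower-neighbour (negt eq)      _           _           _ = cong literal-neighbour (sym eq)
  ≺-lower-neighbour vlit           _           (inj₁ refl) _ = refl
  ≺-lower-neighbour vlit           _           (inj₂ ())   _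

  ≺-one-upper : ∀ {x y z} → Adj y x → Adj y z → OnBaseline y → OnBaseline x → OnBaseline z →
                y ≺ x → y ≺ z → x ≡ z
  ≺-one-upper (triangle _)   (triangle _)   (inj₂ refl) (inj₁ refl) (inj₁ refl) _ _ = refl
  ≺-one-upper (triangle U≢U) _              (inj₂ refl) (inj₂ refl) _           _ _ = ⊥-elim (U≢U refl)
  ≺-one-upper _              (triangle U≢U) (inj₂ refl) _           (inj₂ refl) _ _ = ⊥-elim (U≢U refl)
  ≺-one-upper (triangle T≢T) _              (inj₁ refl) (inj₁ refl) _           _ _ = ⊥-elim (T≢T refl)
  ≺-one-upper (triangle _)   _              (inj₁ refl) (inj₂ refl) _           () _
  ≺-one-upper _              (triangle T≢T) (inj₁ refl) _           (inj₁ refl) _ _ = ⊥-elim (T≢T refl)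
  ≺-one-upper _              (triangle _)   (inj₁ refl) _           (inj₂ refl) _ ()
  ≺-one-upper (tneg {i} {j} eq) (tneg {j = j′} eq′) _ (inj₁ refl) (inj₁ refl) _ _
    with refl ← negAtMost1 i j j′ (lookup∈ eq) (lookup∈ eq′) = refl
  ≺-one-upper (tneg _)       _              _           (inj₂ ())   _           _ _
  ≺-one-upper _              (tneg _)       _           _           (inj₂ ())   _ _
  ≺-one-upper (fpos _)       _              (inj₁ ())   _           _           _ _
  ≺-one-upper (fpos _)       _              (inj₂ ())   _           _           _ _
  ≺-one-upper (litlit p≢p)   _              (inj₁ refl) (inj₁ refl) _           _ _ = ⊥-elim (p≢p refl)
  ≺-one-upper _              (litlit p≢p)   (inj₁ refl) _           (inj₁ refl) _ _ = ⊥-elim (p≢p refl)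
  ≺-one-upper (litlit _)     _              _           (inj₂ ())   _           _ _
  ≺-one-upper _              (litlit _)     _           _           (inj₂ ())   _ _
  ≺-one-upper litv           litv           _           _           _           _ _ = refl
  ≺-one-upper (posf _)       _              _           (inj₁ ())   _           _ _
  ≺-one-upper (posf _)       _              _           (inj₂ ())   _           _ _
  ≺-one-upper _              (posf _)       _           _           (inj₁ ())   _ _
  ≺-one-upper _              (posf _)       _           _           (inj₂ ())   _ _
  ≺-one-upper (negt _)       _              _           _           _           (s≤s ()) _
  ≺-one-upper _              (negt _)       _           _           _           _ (s≤s ())
  ≺-one-upper vlit           _              _           _           _           (s≤s (s≤s ())) _

  baseline-acyclic : IsAcyclic Baseline.chosen
  baseline-acyclic =
    Layering.layered⇒¬CycleIn Adj (ends Baseline.chosen) Adj-sym _≺_ <-trans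
      (λ x∈ y∈ e → ≺-comparable e (on x∈) (on y∈))
      (λ x∈ y∈ z∈ eyx eyz x≺y z≺y →
         trans (≺-lower-neighbour eyx (on y∈) (on x∈) x≺y) (sym (≺-lower-neighbour eyz (on y∈) (on z∈) z≺y)))
      (λ x∈ y∈ z∈ eyx eyz y≺x y≺z → ≺-one-upper eyx eyz (on y∈) (on x∈) (on z∈) y≺x y≺z)
    where
    on : ∀ {x} → x ∈ ends Baseline.chosen → OnBaseline x
    on = Baseline.covered⇒chosen

  module FromAssignment (a : Fin n → Bool) (sat : ∀ j → Any (evalLit a) (c j)) where

    witness : ∀ j → Fin (length (c j))
    witness j = Any.index (sat j)

    open Chosen a witness

    private
      chosen-F : ∀ {i} b → tri i F ≡ tri i (value b) → b ≡ false
      chosen-F false _ = refl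
      chosen-F true  ()

      chosen-T : ∀ {i} b → tri i T ≡ tri i (value b) → b ≡ true
      chosen-T true  _ = refl
      chosen-T false ()

      b≡true⇒b≢false : ∀ {b} → b ≡ true → b ≡ false → ⊥
      b≡true⇒b≢false refl ()

      chosen-literal-true : ∀ {j ℓ} → lookup (c j) (witness j) ≡ ℓ → evalLit a ℓ
      chosen-literal-true {j} eq = subst (evalLit a) eq (lookup-index (sat j))

      same-part : ∀ {x y} → Adj x y → InChoice a witness x → InChoice a witness y → part x ≡ part y
      same-part (triangle _) _ _ = refl
      same-part (litlit _)   _ _ = refl
      same-part litv         _ _ = refl
      same-part vlit         _ _ = refl
      same-part (fpos eq) (inj₁ f) (inj₁ refl) = ⊥-elim (b≡true⇒b≢false (chosen-literal-true eq) (chosen-F _ f))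
      same-part (fpos eq) (inj₂ ()) _
      same-part (fpos eq) _ (inj₂ ())
      same-part (posf eq) (inj₁ refl) (inj₁ f) = ⊥-elim (b≡true⇒b≢false (chosen-literal-true eq) (chosen-F _ f))
      same-part (posf eq) (inj₂ ()) _
      same-part (posf eq) _ (inj₂ ())
      same-part (tneg eq) (inj₁ t) (inj₁ refl) = ⊥-elim (b≡true⇒b≢false (chosen-T _ t) (chosen-literal-true eq))
      same-part (tneg eq) (inj₂ ()) _
      same-part (tneg eq) _ (inj₂ ())
      same-part (negt eq) (inj₁ refl) (inj₁ t) = ⊥-elim (b≡true⇒b≢false (chosen-T _ t) (chosen-literal-true eq))
      same-part (negt eq) (inj₂ ()) _
      same-part (negt eq) _ (inj₂ ())

    induced : IsInduced chosen
    induced = chosen-induced (λ x∈ y∈ e → same-part e (covered⇒chosen x∈) (covered⇒chosen y∈))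

  literal-end : ∀ {j a b} → a ≢ b → part a ≡ inj₂ j → part b ≡ inj₂ j → ∃ λ q → lit j q ∈ₑ (a , b)
  literal-end {a = lit _ q}              _   refl _    = q , inj₁ refl
  literal-end {a = cv _}    {b = lit _ q} _   refl refl = q , inj₂ refl
  literal-end {a = cv _}    {b = cv _}    a≢b refl refl = ⊥-elim (a≢b refl)
  literal-end {a = cv _}    {b = tri _ _} _   refl ()
  literal-end {a = tri _ _}              _   ()   _

  f-end : ∀ {i a b} → a ≢ b → part a ≡ inj₁ i → part b ≡ inj₁ i → ¬ tri i T ∈ₑ (a , b) → tri i F ∈ₑ (a , b)
  f-end {a = tri _ F}              _   refl _    _  = inj₁ refl
  f-end {a = tri _ T}              _   refl _    t∉ = ⊥-elim (t∉ (inj₁ refl))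
  f-end {a = tri _ U} {b = tri _ F} _   refl refl _  = inj₂ refl
  f-end {a = tri _ U} {b = tri _ T} _   refl refl t∉ = ⊥-elim (t∉ (inj₂ refl))
  f-end {a = tri _ U} {b = tri _ U} a≢b refl refl _  = ⊥-elim (a≢b refl)
  f-end {a = tri _ U} {b = lit _ _} _   refl ()   _
  f-end {a = tri _ U} {b = cv _}    _   refl ()   _
  f-end {a = lit _ _}              _   ()   _    _
  f-end {a = cv _}                 _   ()   _    _

  f-vertex? : ∀ i x → Dec (tri i F ≡ x)
  f-vertex? i (tri i′ F) = map′ (cong (λ k → tri k F)) (λ { refl → refl }) (i Fin.≟ i′)
  f-vertex? i (tri _ T)  = no λ ()
  f-vertex? i (tri _ U)  = no λ ()
  f-vertex? i (lit _ _)  = no λ ()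
  f-vertex? i (cv _)     = no λ ()

  module FromInduced {M} (mt : IsMatching M) (ind : IsInduced M) (big : length parts ≤ length M) where

    f-covered? : ∀ i → Dec (tri i F ∈ ends M)
    f-covered? i = any? (f-vertex? i) (ends M)

    assignment : Fin n → Bool
    assignment i = not (does (f-covered? i))

    f-uncovered⇒true : ∀ {i} → tri i F ∉ ends M → assignment i ≡ true
    f-uncovered⇒true {i} f∉ with f-covered? i
    ... | yes f∈ = ⊥-elim (f∉ f∈)
    ... | no _   = refl

    f-covered⇒false : ∀ {i} → tri i F ∈ ends M → assignment i ≡ false
    f-covered⇒false {i} f∈ with f-covered? i
    ... | yes _  = refl
    ... | no f∉  = ⊥-elim (f∉ f∈)

    t-uncovered⇒f-covered : ∀ {i} → tri i T ∉ ends M → tri i F ∈ ends M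
    t-uncovered⇒f-covered {i} t∉ with A , A∈ , A≢ , inA ← edge-in-each-part mt ind big (inj₁ i) =
      ∈ₑ⇒∈ends A∈ (f-end A≢ (inA (inj₁ refl)) (inA (inj₂ refl)) (t∉ ∘ ∈ₑ⇒∈ends A∈))

    satisfied : ∀ j → Any (evalLit assignment) (c j)
    satisfied j
      with A , A∈ , A≢ , inA ← edge-in-each-part mt ind big (inj₂ j)
      with q , qA ← literal-end A≢ (inA (inj₁ refl)) (inA (inj₂ refl)) =
      Any.map (λ { refl → literal-true (lookup (c j) q) refl }) (∈-lookup q)
      where
      -- The edge of M inside C_j is a whole component of G(M).
      outside-uncovered : ∀ {w} → part w ≢ inj₂ j → Adj (lit j q) w → w ∉ ends M
      outside-uncovered w∉C e w∈ = w∉C (inA (induced-covered-neighbour mt ind A∈ qA w∈ e))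

      literal-true : ∀ ℓ → lookup (c j) q ≡ ℓ → evalLit assignment ℓ
      literal-true (pos i) eq = f-uncovered⇒true (outside-uncovered (λ ()) (posf eq))
      literal-true (neg i) eq = f-covered⇒false (t-uncovered⇒f-covered (outside-uncovered (λ ()) (negt eq)))

lemma2 : ∀ {n m : ℕ} (c : Fin m → List (Lit n)) → Restricted c →
         Satisfiable c ⇔ GraphNotions.NuAcEqNuS (Construction.Adj c)
lemma2 c R = mk⇔ satisfiable⇒ν-equal ν-equal⇒satisfiable
  where
  open Reduction c R

  ν-ac : IsNuAc (length parts)
  ν-ac = (Baseline.chosen , Baseline.chosen-matching , baseline-acyclic , Baseline.length-chosen) ,
         λ _ mt ac → acyclic-length≤ mt ac

  satisfiable⇒ν-equal : Satisfiable c → NuAcEqNuS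
  satisfiable⇒ν-equal (a , sat) =
    length parts , ν-ac , (chosen , chosen-matching , induced , length-chosen) ,
    λ _ mt ind → acyclic-length≤ mt (induced⇒acyclic mt ind)
    where
    open FromAssignment a sat
    open Chosen a witness

  ν-equal⇒satisfiable : NuAcEqNuS → Satisfiable c
  ν-equal⇒satisfiable (_ , (_ , ac-max) , (M , mt , ind , refl) , _) = assignment , satisfied
    where
    big : length parts ≤ length M
    big = subst (_≤ length M) Baseline.length-chosen
                (ac-max Baseline.chosen Baseline.chosen-matching baseline-acyclic)
    open FromInduced mt ind big
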